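{- Let $G$ be a directed acyclic graph and $s$ a vertex. For any values of the registers $R_v$, running $\mathrm{WalkOnce}(G,s,\mathrm{Fwd})$ followed by $\mathrm{WalkOnce}(G,s,\mathrm{Rev})$ leaves every register $R_v$ with the same value it had before the two runs.
   Context: Fix $\ell\in\mathbb{N}$. There is one $\ell$-bit register $R_v\in\{0,\dots,2^\ell-1\}$ per vertex $v$. $d_{\mathrm{out}}(v)$ is the out-degree of $v$ and its out-edges are indexed $0,\dots,d_{\mathrm{out}}(v)-1$. Procedure $\mathrm{WalkOnce}(G,s,\mathrm{mode})$: set $v\gets s$; while $d_{\mathrm{out}}(v)>0$: if mode is Fwd, set $r\gets R_v \bmod d_{\mathrm{out}}(v)$ then $R_v\gets(R_v+1)\bmod 2^\ell$; if mode is Rev, set $R_v\gets (R_v-1)\bmod 2^\ell$ then $r\gets R_v\bmod d_{\mathrm{out}}(v)$; then set $v$ to the endpoint of the $r$-th out-edge of $v$. Return $v$. -}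

module Defs where

open import Data.Nat using (ℕ; zero; suc; _+_; _∸_; _^_; _<_; _%_; NonZero)
open import Data.Nat.Properties using (m^n≢0)
open import Data.Nat.DivMod using (_mod_)
open import Data.Fin using (Fin)
open import Data.Fin.Properties using (_≟_)
open import Data.List using (List; length; lookup)
open import Data.List.Membership.Propositional using (_∈_)
open import Data.Bool using (if_then_else_)
open import Relation.Nullary using (¬_; does)
open import Relation.Binary.PropositionalEquality using (_≡_)
open import Relation.Binary.Construct.Closure.Transitive using (TransClosure)

-- A finite directed multigraph on vertex set Fin n: each vertex v has an
-- ordered list of out-neighbours; the r-th entry of  out v  is the endpoint of
-- the r-th out-edge of v (edges indexed 0,…,d_out(v)-1).
record Graph (n : ℕ) : Set where
  field
    out : Fin n → List (Fin n)
open Graph public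

dout : ∀ {n} → Graph n → Fin n → ℕ
dout G v = length (out G v)

Edge : ∀ {n} → Graph n → Fin n → Fin n → Set
Edge G u w = w ∈ out G u

Acyclic : ∀ {n} → Graph n → Set
Acyclic {n} G = ∀ (v : Fin n) → ¬ TransClosure (Edge G) v v

Registers : ℕ → Set
Registers n = Fin n → ℕ

ValidRegs : ∀ {n} → ℕ → Registers n → Set
ValidRegs ℓ R = ∀ v → R v < 2 ^ ℓ

setReg : ∀ {n} → Registers n → Fin n → ℕ → Registers n
setReg R v x u = if does (u ≟ v) then x else R u

mod2^ : ℕ → ℕ → ℕ
mod2^ ℓ x = _%_ x (2 ^ ℓ) {{m^n≢0 2 ℓ}}

incr decr : ℕ → ℕ → ℕ
incr ℓ x = mod2^ ℓ (x + 1)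
-- (x - 1) mod 2^ℓ for x ∈ {0,…,2^ℓ-1}, computed as (x + 2^ℓ - 1) mod 2^ℓ
decr ℓ x = mod2^ ℓ (x + (2 ^ ℓ ∸ 1))

data Mode : Set where
  Fwd Rev : Mode

-- Big-step semantics of WalkOnce:
--   WalkOnce ℓ G mode v R t R'  means: running the loop of WalkOnce(G, ·, mode)
--   from current vertex v with register contents R terminates, returning t,
--   with final register contents R'.
data WalkOnce {n : ℕ} (ℓ : ℕ) (G : Graph n) : Mode → Fin n → Registers n → Fin n → Registers n → Set where
  stop : ∀ {mode v R} → dout G v ≡ 0 → WalkOnce ℓ G mode v R v R
  stepFwd : ∀ {v R t R'} .{{_ : NonZero (dout G v)}} →
    WalkOnce ℓ G Fwd (lookup (out G v) (R v mod dout G v)) (setReg R v (incr ℓ (R v))) t R' →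
    WalkOnce ℓ G Fwd v R t R'
  stepRev : ∀ {v R t R'} .{{_ : NonZero (dout G v)}} →
    WalkOnce ℓ G Rev (lookup (out G v) (decr ℓ (R v) mod dout G v)) (setReg R v (decr ℓ (R v))) t R' →
    WalkOnce ℓ G Rev v R t R'

{-# OPTIONS --safe #-}
module Submission where

open import Defs
open import Data.Nat using (ℕ; suc; _+_; _∸_; _^_; _<_; _%_; NonZero; ≢-nonZero; ≢-nonZero⁻¹)
open import Data.Nat.Properties using (m^n≢0; +-assoc) renaming (_≟_ to _≟ℕ_)
open import Data.Nat.DivMod using (_mod_; %-distribˡ-+; m%n%n≡m%n; [m+n]%n≡m%n; m<n⇒m%n≡m; m%n<n)
open import Data.Fin using (Fin)
open import Data.Fin.Properties using (_≟_)
open import Data.Fin.Induction using (spo-noetherian)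
open import Data.List using (lookup)
open import Data.List.Membership.Propositional.Properties using (∈-lookup)
open import Data.Product using (Σ; _×_; _,_; ∃₂; map₂)
open import Data.Empty using (⊥-elim)
open import Function using (flip; _∘_)
open import Relation.Nullary using (¬_; yes; no)
open import Relation.Binary.Core using (Rel)
open import Relation.Binary.PropositionalEquality
  using (_≡_; _≢_; refl; trans; cong; subst; isEquivalence; module ≡-Reasoning)
open import Relation.Binary.Construct.Closure.Transitive using (TransClosure; [_]; _∷_; _++_)
open import Relation.Binary.Construct.Closure.ReflexiveTransitive using (Star; ε; _◅_)
open import Relation.Binary.Structures using (IsStrictPartialOrder)
open import Induction.WellFounded using (Acc; acc; WellFounded)

-- On a DAG the forward walk never revisits a vertex, so when it leaves v the
-- register R v has been incremented exactly once and is never touched again.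
-- The reverse walk, arriving at v with that value, decrements it back to R v,
-- hence reads the same index and follows the same edge; by induction along the
-- path it retraces the forward walk and restores every register it passes.
-- Registers off the path are touched by neither walk.

open ≡-Reasoning

[m%d+n]%d≡[m+n]%d : ∀ m n d .{{_ : NonZero d}} → (m % d + n) % d ≡ (m + n) % d
[m%d+n]%d≡[m+n]%d m n d = begin
  (m % d + n) % d         ≡⟨ %-distribˡ-+ (m % d) n d ⟩
  (m % d % d + n % d) % d ≡⟨ cong (λ x → (x + n % d) % d) (m%n%n≡m%n m d) ⟩
  (m % d + n % d) % d     ≡⟨ %-distribˡ-+ m n d ⟨
  (m + n) % d             ∎

[[m+1]%d+[d∸1]]%d≡m : ∀ {m d} .{{_ : NonZero d}} → m < d → ((m + 1) % d + (d ∸ 1)) % d ≡ m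
[[m+1]%d+[d∸1]]%d≡m {m} {d@(suc k)} m<d = begin
  ((m + 1) % d + k) % d ≡⟨ [m%d+n]%d≡[m+n]%d (m + 1) k d ⟩
  (m + 1 + k) % d       ≡⟨ cong (_% d) (+-assoc m 1 k) ⟩
  (m + d) % d           ≡⟨ [m+n]%n≡m%n m d ⟩
  m % d                 ≡⟨ m<n⇒m%n≡m m<d ⟩
  m                     ∎

decr-incr : ∀ ℓ {x} → x < 2 ^ ℓ → decr ℓ (incr ℓ x) ≡ x
decr-incr ℓ = [[m+1]%d+[d∸1]]%d≡m {{m^n≢0 2 ℓ}}

incr<2^ℓ : ∀ ℓ x → incr ℓ x < 2 ^ ℓ
incr<2^ℓ ℓ x = m%n<n (x + 1) (2 ^ ℓ) {{m^n≢0 2 ℓ}}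

module _ {n : ℕ} where

  setReg-same : ∀ (R : Registers n) v x → setReg R v x v ≡ x
  setReg-same R v x with v ≟ v
  ... | yes _   = refl
  ... | no v≢v = ⊥-elim (v≢v refl)

  setReg-other : ∀ (R : Registers n) {v u} x → u ≢ v → setReg R v x u ≡ R u
  setReg-other R {v} {u} x u≢v with u ≟ v
  ... | yes u≡v = ⊥-elim (u≢v u≡v)
  ... | no _    = refl

  setReg-valid : ∀ {ℓ} {R : Registers n} → ValidRegs ℓ R → ∀ v {x} → x < 2 ^ ℓ →
                 ValidRegs ℓ (setReg R v x)
  setReg-valid valid v x<2^ℓ u with u ≟ v
  ... | yes _ = x<2^ℓ
  ... | no _  = valid u

◅⇒⁺ : ∀ {a r} {A : Set a} {_∼_ : Rel A r} {x y z} → x ∼ y → Star _∼_ y z → TransClosure _∼_ x z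
◅⇒⁺ x∼y ε            = [ x∼y ]
◅⇒⁺ x∼y (y∼w ◅ w∼⋆z) = x∼y ∷ ◅⇒⁺ y∼w w∼⋆z

module _ {n : ℕ} (G : Graph n) where

  Reachable : Fin n → Fin n → Set
  Reachable = Star (Edge G)

  acyclic⇒¬return : Acyclic G → ∀ {v w} → Edge G v w → ¬ Reachable w v
  acyclic⇒¬return acyclic e w⇝v = acyclic _ (◅⇒⁺ e w⇝v)

  edge⁺-isStrictPartialOrder : Acyclic G → IsStrictPartialOrder _≡_ (TransClosure (Edge G))
  edge⁺-isStrictPartialOrder acyclic = record
    { isEquivalence = isEquivalence
    ; irrefl        = λ { refl → acyclic _ }
    ; trans         = _++_
    ; <-resp-≈      = (λ { refl p → p }) , (λ { refl p → p })
    }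

  edge⁺-noetherian : Acyclic G → WellFounded (flip (TransClosure (Edge G)))
  edge⁺-noetherian = spo-noetherian ∘ edge⁺-isStrictPartialOrder

  module _ (ℓ : ℕ) where

    walkOnce-preserves-unreachable : ∀ {mode v R t R'} → WalkOnce ℓ G mode v R t R' →
                                     ∀ u → ¬ Reachable v u → R' u ≡ R u
    walkOnce-preserves-unreachable (stop _) u _ = refl
    walkOnce-preserves-unreachable {R = R} (stepFwd walk) u v↛u =
      trans (walkOnce-preserves-unreachable walk u (v↛u ∘ (∈-lookup _ ◅_)))
            (setReg-other R _ λ { refl → v↛u ε })
    walkOnce-preserves-unreachable {R = R} (stepRev walk) u v↛u =
      trans (walkOnce-preserves-unreachable walk u (v↛u ∘ (∈-lookup _ ◅_)))
            (setReg-other R _ λ { refl → v↛u ε })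

    walkOnce-terminates : Acyclic G → ∀ mode v R → ∃₂ λ t R' → WalkOnce ℓ G mode v R t R'
    walkOnce-terminates acyclic mode v = go mode v (edge⁺-noetherian acyclic v)
      where
      go : ∀ mode v → Acc (flip (TransClosure (Edge G))) v → ∀ R → ∃₂ λ t R' → WalkOnce ℓ G mode v R t R'
      go mode v (acc rec) R with dout G v ≟ℕ 0
      ... | yes d≡0 = v , R , stop d≡0
      ... | no d≢0  = step mode
        where
        instance
          d≢0′ : NonZero (dout G v)
          d≢0′ = ≢-nonZero d≢0

        step : ∀ mode → ∃₂ λ t R' → WalkOnce ℓ G mode v R t R'
        step Fwd = map₂ (map₂ stepFwd) (go Fwd _ (rec [ ∈-lookup (R v mod dout G v) ]) _)
        step Rev = map₂ (map₂ stepRev) (go Rev _ (rec [ ∈-lookup (decr ℓ (R v) mod dout G v) ]) _)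

    -- Pointwise in u, since agreement on all of Reachable v would need reachability
    -- to be decided (u may be reachable only through edges the walk does not take).
    rev-undoes-fwd : Acyclic G → ∀ {v R t R₁} → WalkOnce ℓ G Fwd v R t R₁ → ValidRegs ℓ R →
                     ∀ {S t′ S′} → (∀ {u} → Reachable v u → S u ≡ R₁ u) → WalkOnce ℓ G Rev v S t′ S′ →
                     ∀ u → S u ≡ R₁ u → S′ u ≡ R u
    rev-undoes-fwd _ (stop _) _ _ (stop _) _ Su≡R₁u = Su≡R₁u
    rev-undoes-fwd _ {v} (stop d≡0) _ _ (stepRev _) _ _ = ⊥-elim (≢-nonZero⁻¹ (dout G v) d≡0)
    rev-undoes-fwd _ {v} (stepFwd _) _ _ (stop d≡0) _ _ = ⊥-elim (≢-nonZero⁻¹ (dout G v) d≡0)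
    rev-undoes-fwd acyclic {v} {R} {R₁ = R₁} (stepFwd fwd) valid {S} {t′} {S′} S≈R₁ (stepRev rev) =
      retraced
      where
      e : Edge G v (lookup (out G v) (R v mod dout G v))
      e = ∈-lookup _

      w↛v : ¬ Reachable (lookup (out G v) (R v mod dout G v)) v
      w↛v = acyclic⇒¬return acyclic e

      decr-Sv : decr ℓ (S v) ≡ R v
      decr-Sv = begin
        decr ℓ (S v)                             ≡⟨ cong (decr ℓ) (S≈R₁ ε) ⟩
        decr ℓ (R₁ v)                            ≡⟨ cong (decr ℓ) (walkOnce-preserves-unreachable fwd v w↛v) ⟩
        decr ℓ (setReg R v (incr ℓ (R v)) v)     ≡⟨ cong (decr ℓ) (setReg-same R v _) ⟩
        decr ℓ (incr ℓ (R v))                    ≡⟨ decr-incr ℓ (valid v) ⟩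
        R v                                      ∎

      rev′ : WalkOnce ℓ G Rev (lookup (out G v) (R v mod dout G v)) (setReg S v (R v)) t′ S′
      rev′ = subst (λ x → WalkOnce ℓ G Rev (lookup (out G v) (x mod dout G v)) (setReg S v x) t′ S′)
                   decr-Sv rev

      ih : ∀ u → setReg S v (R v) u ≡ R₁ u → S′ u ≡ setReg R v (incr ℓ (R v)) u
      ih = rev-undoes-fwd acyclic fwd (setReg-valid {ℓ = ℓ} valid v (incr<2^ℓ ℓ (R v)))
             (λ w⇝u → trans (setReg-other S _ λ { refl → w↛v w⇝u }) (S≈R₁ (e ◅ w⇝u)))
             rev′

      retraced : ∀ u → S u ≡ R₁ u → S′ u ≡ R u
      retraced u Su≡R₁u with u ≟ v
      ... | yes refl = trans (walkOnce-preserves-unreachable rev′ v w↛v) (setReg-same S v (R v))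
      ... | no u≢v   = trans (ih u (trans (setReg-other S _ u≢v) Su≡R₁u)) (setReg-other R _ u≢v)

lemma4p6 : (ℓ n : ℕ) (G : Graph n) → Acyclic G → (s : Fin n) (R : Registers n) → ValidRegs ℓ R →
    (Σ (Fin n) λ t₁ → Σ (Registers n) λ R₁ → Σ (Fin n) λ t₂ → Σ (Registers n) λ R₂ →
       WalkOnce ℓ G Fwd s R t₁ R₁ × WalkOnce ℓ G Rev s R₁ t₂ R₂)
    × (∀ t₁ R₁ t₂ R₂ → WalkOnce ℓ G Fwd s R t₁ R₁ → WalkOnce ℓ G Rev s R₁ t₂ R₂ →
       ∀ v → R₂ v ≡ R v)
lemma4p6 ℓ n G acyclic s R valid =
  let t₁ , R₁ , fwd = walkOnce-terminates G ℓ acyclic Fwd s R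
      t₂ , R₂ , rev = walkOnce-terminates G ℓ acyclic Rev s R₁
  in (t₁ , R₁ , t₂ , R₂ , fwd , rev)
   , λ _ _ _ _ fwd rev v → rev-undoes-fwd G ℓ acyclic fwd valid (λ _ → refl) rev v refl
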